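{- Let $r$ be the number of maximal equal-letter runs in the Burrows-Wheeler transform of a string $T$. Then $T$ has a string attractor of size $r$.
   Context: A string attractor of a string $T$ of length $n$ is a set $\Gamma\subseteq\{1,\dots,n\}$ such that every substring $T[i..j]$ has an occurrence $T[i'..j']=T[i..j]$ with $p\in[i',j']$ for some $p\in\Gamma$. It is assumed that $T[n]=\$$, a symbol not occurring elsewhere in $T$ and lexicographically smaller than all other symbols. The suffix array $SA$ of $T$ is the permutation of $[1..n]$ listing starting positions of suffixes in lexicographic order; the Burrows-Wheeler transform is $BWT[i]=T[SA[i]-1]$ if $SA[i]>1$ and $\$$ otherwise (equivalently, the last column of the lexicographically sorted matrix of cyclic rotations of $T$). -}

module Defs where

open import Data.Nat using (ℕ; zero; suc; _+_; _<_; _≤_)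
open import Data.Nat.Properties using (_≟_)
open import Data.List using (List; []; _∷_; _++_; length; take; drop; map; upTo)
open import Data.List.Relation.Unary.All using (All)
open import Data.List.Relation.Unary.Any using (Any)
open import Data.List.Relation.Unary.Linked using (Linked)
open import Data.List.Relation.Unary.Unique.Propositional using (Unique)
open import Data.List.Relation.Binary.Permutation.Propositional using (_↭_)
open import Data.List.Relation.Binary.Lex.Strict using (Lex-<)
open import Data.Product using (Σ; ∃; _×_)
open import Relation.Binary.PropositionalEquality using (_≡_)
open import Relation.Nullary using (yes; no)

-- The end marker $ is the symbol 0; all other symbols are ≥ 1.
-- A text is  T = w ++ [ 0 ]  where every letter of w is positive.
-- Positions are 0-based: 0 .. n-1 with n = length T.

$ : ℕ
$ = 0

text : List ℕ → List ℕ
text w = w ++ ($ ∷ [])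

ValidWord : List ℕ → Set
ValidWord w = All (λ c → 0 < c) w

-- character at position i (default $ out of range; only used in range)
at : List ℕ → ℕ → ℕ
at []       _       = $
at (x ∷ xs) zero    = x
at (x ∷ xs) (suc i) = at xs i

substr : List ℕ → ℕ → ℕ → List ℕ
substr T i len = take len (drop i T)

suffix : List ℕ → ℕ → List ℕ
suffix T i = drop i T

-- strict lexicographic order on strings (a proper prefix is smaller)
_<lex_ : List ℕ → List ℕ → Set
_<lex_ = Lex-< _≡_ _<_

IsSuffixArray : List ℕ → List ℕ → Set
IsSuffixArray T SA =
  (SA ↭ upTo (length T)) × Linked (λ i j → suffix T i <lex suffix T j) SA

-- BWT[k] = T[SA[k]-1] (0-based), and $ if SA[k] is the first position.
bwtChar : List ℕ → ℕ → ℕ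
bwtChar T zero    = $
bwtChar T (suc i) = at T i

BWT : List ℕ → List ℕ → List ℕ
BWT T SA = map (bwtChar T) SA

boundaries : ℕ → List ℕ → ℕ
boundaries prev []       = 0
boundaries prev (y ∷ ys) with prev ≟ y
... | yes _ = boundaries y ys
... | no  _ = suc (boundaries y ys)

runs : List ℕ → ℕ
runs []       = 0
runs (x ∷ xs) = suc (boundaries x xs)

IsAttractor : List ℕ → List ℕ → Set
IsAttractor T Γ =
  All (λ p → p < length T) Γ ×
  (∀ i len → 1 ≤ len → i + len ≤ length T →
    ∃ λ i' → (i' + len ≤ length T) × (substr T i' len ≡ substr T i len) ×
      Any (λ p → (i' ≤ p) × (p < i' + len)) Γ)

HasAttractorOfSize : List ℕ → ℕ → Set
HasAttractorOfSize T k =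
  Σ (List ℕ) λ Γ → Unique Γ × (length Γ ≡ k) × IsAttractor T Γ

module Submission where

-- Take Γ = { SA[k] − 1 : a run of the BWT starts at k }, read cyclically so that
-- SA[k] = 0 contributes the last position n − 1; then |Γ| = r. Let the window
-- T[p .. p+L] avoid Γ (hence also avoid n − 1). The rank k₁ of suffix p + 1 does
-- not start a run, so BWT[k₁ − 1] = BWT[k₁] = T[p]. Prepending that letter to
-- suffix SA[k₁ − 1], which by induction on L shares L letters with suffix p + 1,
-- gives a suffix smaller than suffix p sharing L + 1 letters with it; as suffixes
-- are sorted lexicographically, the suffix just before suffix p in SA shares them
-- too. So the window also occurs at the previous SA rank, and descending through
-- the ranks we must reach an occurrence that meets Γ.

open import Defs
open import Data.Nat using (ℕ; zero; suc; _+_; _∸_; _<_; _≤_; z≤n; s≤s; _≤?_; _<?_)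
open import Data.Nat.Properties
open import Data.List using (List; []; _∷_; length; take; drop; map; upTo)
open import Data.List.Properties using (length-map; length-upTo; length-take; ∷-injectiveˡ; ∷-injectiveʳ)
open import Data.List.Relation.Unary.All as All using (All; []; _∷_)
open import Data.List.Relation.Unary.All.Properties using (map⁺)
open import Data.List.Relation.Unary.Any as Any using (Any; here; there; any?)
open import Data.List.Relation.Unary.Linked using (Linked; []; [-]; _∷_)
open import Data.List.Relation.Unary.Unique.Propositional using (Unique; []; _∷_)
open import Data.List.Relation.Binary.Permutation.Propositional using (_↭_; ↭-sym)
open import Data.List.Relation.Binary.Permutation.Propositional.Properties using (∈-resp-↭; ↭-length)
import Data.List.Relation.Binary.Pointwise as Pointwise
import Data.List.Relation.Binary.Lex.Strict as Lex
open import Data.List.Relation.Binary.Lex.Core using (halt; this; next; base)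
open import Data.List.Membership.Propositional using (_∈_)
open import Data.List.Membership.Propositional.Properties using (∈-upTo⁺; ∈-upTo⁻; ∈-map⁺)
open import Data.Product using (∃; _×_; _,_; proj₁; proj₂)
open import Data.Sum using (_⊎_; inj₁; inj₂)
open import Data.Empty using (⊥-elim)
open import Function using (_∘_)
open import Relation.Binary using (Transitive; StrictPartialOrder)
open import Relation.Binary.PropositionalEquality
open import Relation.Binary.Definitions using (tri<; tri≈; tri>)
open import Relation.Nullary using (yes; no; ¬_; Dec)
open import Relation.Nullary.Decidable using (_×-dec_)

at-map : ∀ {f : ℕ → ℕ} → f $ ≡ $ → ∀ xs k → at (map f xs) k ≡ f (at xs k)
at-map f$≡$ []       k       = sym f$≡$
at-map f$≡$ (x ∷ xs) zero    = refl
at-map f$≡$ (x ∷ xs) (suc k) = at-map f$≡$ xs k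

at-∈ : ∀ xs {k} → k < length xs → at xs k ∈ xs
at-∈ (x ∷ xs) {zero}  _        = here refl
at-∈ (x ∷ xs) {suc k} (s≤s k<) = there (at-∈ xs k<)

∈⇒at : ∀ {x} xs → x ∈ xs → ∃ λ k → k < length xs × at xs k ≡ x
∈⇒at (y ∷ xs) (here refl) = 0 , s≤s z≤n , refl
∈⇒at (y ∷ xs) (there x∈xs) with ∈⇒at xs x∈xs
... | k , k< , xs[k]≡x = suc k , s≤s k< , xs[k]≡x

drop-at : ∀ xs {i} → i < length xs → drop i xs ≡ at xs i ∷ drop (suc i) xs
drop-at (x ∷ xs) {zero}  _        = refl
drop-at (x ∷ xs) {suc i} (s≤s i<) = drop-at xs i<

length-substr : ∀ xs i m → i + m ≤ length xs → length (substr xs i m) ≡ m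
length-substr xs       zero    zero    _        = refl
length-substr (x ∷ xs) zero    (suc m) (s≤s le) = cong suc (length-substr xs zero m le)
length-substr (x ∷ xs) (suc i) m       (s≤s le) = length-substr xs i m le

length-substr⇒fits : ∀ xs i m → 0 < m → length (substr xs i m) ≡ m → i + m ≤ length xs
length-substr⇒fits xs       zero    m       _   eq = m⊓n≡m⇒m≤n (trans (sym (length-take m xs)) eq)
length-substr⇒fits []       (suc i) zero    ()
length-substr⇒fits []       (suc i) (suc m) _   ()
length-substr⇒fits (x ∷ xs) (suc i) m       m>0 eq = s≤s (length-substr⇒fits xs i m m>0 eq)

Linked-at : ∀ {R : ℕ → ℕ → Set} → Transitive R → ∀ {xs} → Linked R xs →
  ∀ {a b} → a < b → b < length xs → R (at xs a) (at xs b)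
Linked-at trans (r ∷ l) {zero}  {suc zero}    _        _         = r
Linked-at trans (r ∷ l) {zero}  {suc (suc b)} _        (s≤s b<) = trans r (Linked-at trans l (s≤s z≤n) b<)
Linked-at trans (r ∷ l) {suc a} {suc b}       (s≤s a<) (s≤s b<) = Linked-at trans l a< b<
Linked-at trans [-]     {_}     {suc b}       _        (s≤s ())

Unique-map⁺ : ∀ {P : ℕ → Set} (f : ℕ → ℕ) → (∀ {a b} → P a → P b → f a ≡ f b → a ≡ b) →
  ∀ {xs} → All P xs → Unique xs → Unique (map f xs)
Unique-map⁺ f inj []         []          = []
Unique-map⁺ f inj (pa ∷ pas) (a∉ ∷ uniq) =
  map⁺ (All.zipWith (λ (pb , a≢b) → a≢b ∘ inj pa pb) (pas , a∉)) ∷ Unique-map⁺ f inj pas uniq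

open StrictPartialOrder (Lex.<-strictPartialOrder <-strictPartialOrder)
  using () renaming (trans to <lex-trans; irrefl to <lex-irrefl′)

<lex-irrefl : ∀ {a} → ¬ (a <lex a)
<lex-irrefl = <lex-irrefl′ (Pointwise.refl refl)

take-between : ∀ m {a b c} → a <lex b → b <lex c → take m a ≡ take m c → take m b ≡ take m a
take-between zero    _              _               _  = refl
take-between (suc m) (base ())      _               _
take-between (suc m) {c = []}       halt ()         _
take-between (suc m) {c = _ ∷ _}    halt _          ()
take-between (suc m) (this x<y)     (this y<z)      eq = ⊥-elim (<-asym x<y (subst (_ <_) (sym (∷-injectiveˡ eq)) y<z))
take-between (suc m) (this x<y)     (next refl _)   eq = ⊥-elim (<-irrefl (∷-injectiveˡ eq) x<y)
take-between (suc m) (next refl _)  (this y<z)      eq = ⊥-elim (<-irrefl (∷-injectiveˡ eq) y<z)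
take-between (suc m) (next refl as) (next refl bs)  eq = cong (_ ∷_) (take-between m as bs (∷-injectiveʳ eq))

runHeadsFrom : ℕ → ℕ → List ℕ → List ℕ
runHeadsFrom prev i []       = []
runHeadsFrom prev i (y ∷ ys) with prev ≟ y
... | yes _ = runHeadsFrom y (suc i) ys
... | no  _ = i ∷ runHeadsFrom y (suc i) ys

runHeads : List ℕ → List ℕ
runHeads []       = []
runHeads (x ∷ xs) = 0 ∷ runHeadsFrom x 1 xs

length-runHeadsFrom : ∀ prev i ys → length (runHeadsFrom prev i ys) ≡ boundaries prev ys
length-runHeadsFrom prev i []       = refl
length-runHeadsFrom prev i (y ∷ ys) with prev ≟ y
... | yes _ = length-runHeadsFrom y (suc i) ys
... | no  _ = cong suc (length-runHeadsFrom y (suc i) ys)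

length-runHeads : ∀ xs → length (runHeads xs) ≡ runs xs
length-runHeads []       = refl
length-runHeads (x ∷ xs) = cong suc (length-runHeadsFrom x 1 xs)

runHeadsFrom-bounded : ∀ prev i ys → All (λ j → i ≤ j × j < i + length ys) (runHeadsFrom prev i ys)
runHeadsFrom-bounded prev i []       = []
runHeadsFrom-bounded prev i (y ∷ ys) with prev ≟ y | All.map widen (runHeadsFrom-bounded y (suc i) ys)
  where
  widen : ∀ {j} → suc i ≤ j × j < suc i + length ys → i ≤ j × j < i + suc (length ys)
  widen {j} (i<j , j<) = <⇒≤ i<j , subst (j <_) (sym (+-suc i _)) j<
... | yes _ | bounded = bounded
... | no  _ | bounded = (≤-refl , m<m+n i (s≤s z≤n)) ∷ bounded

runHeadsFrom-unique : ∀ prev i ys → Unique (runHeadsFrom prev i ys)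
runHeadsFrom-unique prev i []       = []
runHeadsFrom-unique prev i (y ∷ ys) with prev ≟ y
... | yes _ = runHeadsFrom-unique y (suc i) ys
... | no  _ = All.map (λ (i<j , _) i≡j → <-irrefl i≡j i<j) (runHeadsFrom-bounded y (suc i) ys)
              ∷ runHeadsFrom-unique y (suc i) ys

runHeads-unique : ∀ xs → Unique (runHeads xs)
runHeads-unique []       = []
runHeads-unique (x ∷ xs) = All.map (λ (0<j , _) 0≡j → <-irrefl 0≡j 0<j) (runHeadsFrom-bounded x 1 xs)
                           ∷ runHeadsFrom-unique x 1 xs

runHeads-bounded : ∀ xs → All (_< length xs) (runHeads xs)
runHeads-bounded []       = []
runHeads-bounded (x ∷ xs) = s≤s z≤n ∷ All.map proj₂ (runHeadsFrom-bounded x 1 xs)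

∈-runHeadsFrom : ∀ prev i ys {j} → j < length ys → at (prev ∷ ys) j ≢ at ys j → i + j ∈ runHeadsFrom prev i ys
∈-runHeadsFrom prev i (y ∷ ys) {zero}  _        differs with prev ≟ y
... | yes same = ⊥-elim (differs same)
... | no  _    = here (+-identityʳ i)
∈-runHeadsFrom prev i (y ∷ ys) {suc j} (s≤s j<) differs with prev ≟ y
... | yes _ = subst (_∈ runHeadsFrom y (suc i) ys) (sym (+-suc i j)) (∈-runHeadsFrom y (suc i) ys j< differs)
... | no  _ = there (subst (_∈ runHeadsFrom y (suc i) ys) (sym (+-suc i j)) (∈-runHeadsFrom y (suc i) ys j< differs))

runHead-or-repeat : ∀ xs {k} → k < length xs →
  k ∈ runHeads xs ⊎ ∃ λ k′ → k ≡ suc k′ × at xs k′ ≡ at xs k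
runHead-or-repeat (x ∷ xs) {zero}  _        = inj₁ (here refl)
runHead-or-repeat (x ∷ xs) {suc k} (s≤s k<) with at (x ∷ xs) k ≟ at xs k
... | yes same   = inj₂ (k , refl , same)
... | no differs = inj₁ (there (∈-runHeadsFrom x 1 xs k< differs))

cyclicPred : ℕ → ℕ → ℕ
cyclicPred m zero    = m ∸ 1
cyclicPred m (suc s) = s

cyclicPred-bounded : ∀ {m s} → s < m → cyclicPred m s < m
cyclicPred-bounded {suc m} {zero}  _   = n<1+n m
cyclicPred-bounded {suc m} {suc s} s<m = <-trans (n<1+n s) s<m

cyclicPred-injective : ∀ {m s t} → s < m → t < m → cyclicPred m s ≡ cyclicPred m t → s ≡ t
cyclicPred-injective {suc m} {zero}  {zero}  _         _         _  = refl
cyclicPred-injective {suc m} {zero}  {suc t} _         (s≤s t<m) eq = ⊥-elim (<-irrefl (sym eq) t<m)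
cyclicPred-injective {suc m} {suc s} {zero}  (s≤s s<m) _         eq = ⊥-elim (<-irrefl eq s<m)
cyclicPred-injective {suc m} {suc s} {suc t} _         _         eq = cong suc eq

extend-left : ∀ xs {r p L} → r < length xs → p < length xs → at xs r ≡ at xs p →
  suffix xs (suc r) <lex suffix xs (suc p) → substr xs (suc r) L ≡ substr xs (suc p) L →
  suffix xs r <lex suffix xs p × substr xs r (suc L) ≡ substr xs p (suc L)
extend-left xs r< p< same smaller shared rewrite drop-at xs r< | drop-at xs p< =
  next same smaller , cong₂ _∷_ same shared

module SuffixArray (T SA : List ℕ)
  (SA-perm : SA ↭ upTo (length T))
  (SA-sorted : Linked (λ i j → suffix T i <lex suffix T j) SA) where

  n : ℕ
  n = length T

  length-SA : length SA ≡ n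
  length-SA = trans (↭-length SA-perm) (length-upTo n)

  SA-surjective : ∀ {p} → p < n → ∃ λ k → k < n × at SA k ≡ p
  SA-surjective p<n with ∈⇒at SA (∈-resp-↭ (↭-sym SA-perm) (∈-upTo⁺ p<n))
  ... | k , k< , SA[k]≡p = k , subst (k <_) length-SA k< , SA[k]≡p

  SA-bounded : ∀ {k} → k < n → at SA k < n
  SA-bounded {k} k<n = ∈-upTo⁻ (∈-resp-↭ SA-perm (at-∈ SA (subst (k <_) (sym length-SA) k<n)))

  suffix-<lex : ∀ {a b} → a < b → b < n → suffix T (at SA a) <lex suffix T (at SA b)
  suffix-<lex {b = b} a<b b<n = Linked-at <lex-trans SA-sorted a<b (subst (b <_) (sym length-SA) b<n)

  suffix-<lex⁻ : ∀ {a b} → a < n → b < n → suffix T (at SA a) <lex suffix T (at SA b) → a < b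
  suffix-<lex⁻ {a} {b} a<n b<n lt with <-cmp a b
  ... | tri< a<b _ _ = a<b
  ... | tri≈ _ refl _ = ⊥-elim (<lex-irrefl lt)
  ... | tri> _ _ b<a = ⊥-elim (<lex-irrefl (<lex-trans lt (suffix-<lex b<a a<n)))

  SA-injective : ∀ {a b} → a < n → b < n → at SA a ≡ at SA b → a ≡ b
  SA-injective {a} {b} a<n b<n eq with <-cmp a b
  ... | tri< a<b _ _ = ⊥-elim (<lex-irrefl (subst (λ s → suffix T s <lex _) eq (suffix-<lex a<b b<n)))
  ... | tri≈ _ a≡b _ = a≡b
  ... | tri> _ _ b<a = ⊥-elim (<lex-irrefl (subst (λ s → _ <lex suffix T s) eq (suffix-<lex b<a a<n)))

  -- The SA-predecessor of suffix p lies lexicographically between suffix r and suffix p.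
  predecessor-shares-prefix : ∀ m {k p r} → k < n → at SA k ≡ p → r < n →
    suffix T r <lex suffix T p → substr T r m ≡ substr T p m →
    ∃ λ k′ → k ≡ suc k′ × substr T (at SA k′) m ≡ substr T p m
  predecessor-shares-prefix m {k} k<n refl r<n r<p shared with SA-surjective r<n
  ... | kᵣ , kᵣ<n , refl with suffix-<lex⁻ kᵣ<n k<n r<p
  ... | s≤s {n = k′} kᵣ≤k′ with m≤n⇒m<n∨m≡n kᵣ≤k′
  ...   | inj₂ refl = k′ , refl , shared
  ...   | inj₁ kᵣ<k′ = k′ , refl ,
          trans (take-between m (suffix-<lex kᵣ<k′ k′<n) (suffix-<lex (n<1+n k′) k<n) shared) shared
    where
    k′<n : k′ < n
    k′<n = <-trans (n<1+n k′) k<n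

module RunHeadAttractor (T SA : List ℕ)
  (SA-perm : SA ↭ upTo (length T))
  (SA-sorted : Linked (λ i j → suffix T i <lex suffix T j) SA)
  (positive : ∀ s → suc s < length T → at T s ≢ $) where

  open SuffixArray T SA SA-perm SA-sorted

  B : List ℕ
  B = BWT T SA

  length-B : length B ≡ n
  length-B = trans (length-map (bwtChar T) SA) length-SA

  at-B : ∀ k → at B k ≡ bwtChar T (at SA k)
  at-B = at-map refl SA

  Γ : List ℕ
  Γ = map (cyclicPred n ∘ at SA) (runHeads B)

  runHeads-B-bounded : All (_< n) (runHeads B)
  runHeads-B-bounded = All.map (λ {k} k< → subst (k <_) length-B k<) (runHeads-bounded B)

  Γ-bounded : All (_< n) Γ
  Γ-bounded = map⁺ (All.map (cyclicPred-bounded ∘ SA-bounded) runHeads-B-bounded)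

  Γ-unique : Unique Γ
  Γ-unique = Unique-map⁺ (cyclicPred n ∘ at SA)
    (λ a<n b<n → SA-injective a<n b<n ∘ cyclicPred-injective (SA-bounded a<n) (SA-bounded b<n))
    runHeads-B-bounded (runHeads-unique B)

  length-Γ : length Γ ≡ runs B
  length-Γ = trans (length-map _ (runHeads B)) (length-runHeads B)

  runHead-or-repeat-B : ∀ {k} → k < n → cyclicPred n (at SA k) ∈ Γ ⊎ ∃ λ k′ → k ≡ suc k′ × at B k′ ≡ at B k
  runHead-or-repeat-B {k} k<n with runHead-or-repeat B (subst (k <_) (sym length-B) k<n)
  ... | inj₁ head   = inj₁ (∈-map⁺ (cyclicPred n ∘ at SA) head)
  ... | inj₂ repeat = inj₂ repeat

  bwtChar-positive : ∀ {s} → s < n → s ≢ 0 → bwtChar T s ≢ $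
  bwtChar-positive {zero}  _   s≢0 = ⊥-elim (s≢0 refl)
  bwtChar-positive {suc s} s<n _   = positive s s<n

  last∈Γ : 0 < n → n ∸ 1 ∈ Γ
  last∈Γ 0<n with SA-surjective 0<n
  ... | k , k<n , SA[k]≡0 with runHead-or-repeat-B k<n
  ...   | inj₁ head = subst (_∈ Γ) (cong (cyclicPred n) SA[k]≡0) head
  ...   | inj₂ (k′ , refl , same) =
          ⊥-elim (bwtChar-positive (SA-bounded k′<n) SA[k′]≢0 (begin
            bwtChar T (at SA k′)  ≡⟨ sym (at-B k′) ⟩
            at B k′               ≡⟨ same ⟩
            at B k                ≡⟨ at-B k ⟩
            bwtChar T (at SA k)   ≡⟨ cong (bwtChar T) SA[k]≡0 ⟩
            $                     ∎))
    where
    open ≡-Reasoning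
    k′<n : k′ < n
    k′<n = <-trans (n<1+n k′) k<n
    SA[k′]≢0 : at SA k′ ≢ 0
    SA[k′]≢0 SA[k′]≡0 = 1+n≢n (SA-injective k<n k′<n (trans SA[k]≡0 (sym SA[k′]≡0)))

  Hits : ℕ → ℕ → Set
  Hits i len = Any (λ x → i ≤ x × x < i + len) Γ

  Hits? : ∀ i len → Dec (Hits i len)
  Hits? i len = any? (λ x → (i ≤? x) ×-dec (x <? i + len)) Γ

  ∈⇒Hits : ∀ {x i len} → x ∈ Γ → i ≤ x → x < i + len → Hits i len
  ∈⇒Hits x∈Γ i≤x x< = Any.map (λ { refl → i≤x , x< }) x∈Γ

  Hits-suc : ∀ {p L} → Hits (suc p) L → Hits p (suc L)
  Hits-suc {p} {L} = Any.map (λ {x} (p<x , x<) → <⇒≤ p<x , subst (x <_) (sym (+-suc p L)) x<)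

  miss⇒before-last : ∀ {p L} → p + suc L ≤ n → ¬ Hits p (suc L) → p + suc L < n
  miss⇒before-last {p} {L} fits miss with m≤n⇒m<n∨m≡n fits
  ... | inj₁ before = before
  ... | inj₂ fills = ⊥-elim (miss (∈⇒Hits p+L∈Γ (m≤m+n p L) (+-monoʳ-< p (n<1+n L))))
    where
    fills′ : suc (p + L) ≡ n
    fills′ = trans (sym (+-suc p L)) fills
    p+L∈Γ : p + L ∈ Γ
    p+L∈Γ = subst (λ m → m ∸ 1 ∈ Γ) (sym fills′) (last∈Γ (subst (0 <_) fills′ (s≤s z≤n)))

  predecessor-shares-extended-prefix : ∀ L {k p r} → k < n → at SA k ≡ p → suc p < n → r < n →
    bwtChar T r ≡ at T p → suffix T r <lex suffix T (suc p) → substr T r L ≡ substr T (suc p) L →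
    ∃ λ k′ → k ≡ suc k′ × substr T (at SA k′) (suc L) ≡ substr T p (suc L)
  predecessor-shares-extended-prefix L {p = p} {zero} _ _ p+1<n _ letter _ _ =
    ⊥-elim (positive p p+1<n (sym letter))
  predecessor-shares-extended-prefix L {p = p} {suc r} k<n SA[k]≡p p+1<n r+1<n letter smaller shared =
    predecessor-shares-prefix (suc L) k<n SA[k]≡p r<n (proj₁ extension) (proj₂ extension)
    where
    r<n : r < n
    r<n = <-trans (n<1+n r) r+1<n
    extension : suffix T r <lex suffix T p × substr T r (suc L) ≡ substr T p (suc L)
    extension = extend-left T r<n (<-trans (n<1+n p) p+1<n) letter smaller shared

  predecessor-shares-window : ∀ L {k p} → k < n → at SA k ≡ p → p + suc L < n → ¬ Hits p (suc L) →
    ∃ λ k′ → k ≡ suc k′ × substr T (at SA k′) (suc L) ≡ substr T p (suc L)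

  predecessor-agrees : ∀ L {k p} → k < n → at SA k ≡ p → p + L < n → ¬ Hits p L →
    ∀ {k′} → k ≡ suc k′ → substr T (at SA k′) L ≡ substr T p L
  predecessor-agrees zero    _   _       _    _    _ = refl
  predecessor-agrees (suc L) k<n SA[k]≡p fits miss refl with predecessor-shares-window L k<n SA[k]≡p fits miss
  ... | _ , refl , shared = shared

  predecessor-shares-window L {k} {p} k<n SA[k]≡p fits miss
    with fits′ ← subst (_< n) (+-suc p L) fits
    with p+1<n ← ≤-<-trans (m≤m+n (suc p) L) fits′
    with SA-surjective p+1<n
  ... | k₁ , k₁<n , SA[k₁]≡p+1 with runHead-or-repeat-B k₁<n
  ...   | inj₁ head =
          ⊥-elim (miss (∈⇒Hits (subst (_∈ Γ) (cong (cyclicPred n) SA[k₁]≡p+1) head) ≤-refl (m<m+n p (s≤s z≤n))))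
  ...   | inj₂ (k₀ , refl , same) =
          predecessor-shares-extended-prefix L k<n SA[k]≡p p+1<n (SA-bounded k₀<n) letter
            (subst (λ s → suffix T (at SA k₀) <lex suffix T s) SA[k₁]≡p+1 (suffix-<lex (n<1+n k₀) k₁<n))
            (predecessor-agrees L k₁<n SA[k₁]≡p+1 fits′ (miss ∘ Hits-suc) refl)
    where
    open ≡-Reasoning
    k₀<n : k₀ < n
    k₀<n = <-trans (n<1+n k₀) k₁<n
    letter : bwtChar T (at SA k₀) ≡ at T p
    letter = begin
      bwtChar T (at SA k₀)       ≡⟨ sym (at-B k₀) ⟩
      at B k₀                    ≡⟨ same ⟩
      at B (suc k₀)              ≡⟨ at-B (suc k₀) ⟩
      bwtChar T (at SA (suc k₀)) ≡⟨ cong (bwtChar T) SA[k₁]≡p+1 ⟩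
      at T p                     ∎

  HitOccurrence : ℕ → ℕ → Set
  HitOccurrence i len = ∃ λ i′ → (i′ + len ≤ n) × (substr T i′ len ≡ substr T i len) × Hits i′ len

  hitOccurrence : ∀ k → k < n → ∀ L → at SA k + suc L ≤ n → HitOccurrence (at SA k) (suc L)
  hitOccurrence k k<n L fits with Hits? (at SA k) (suc L)
  ... | yes hit = at SA k , fits , refl , hit
  ... | no miss with predecessor-shares-window L k<n refl (miss⇒before-last fits miss) miss
  ...   | k′ , refl , shared
          with hitOccurrence k′ (<-trans (n<1+n k′) k<n) L
                 (length-substr⇒fits T (at SA k′) (suc L) (s≤s z≤n)
                   (trans (cong length shared) (length-substr T (at SA k) (suc L) fits)))
  ...     | i′ , fits′ , same , hit = i′ , fits′ , trans same shared , hit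

  Γ-attractor : IsAttractor T Γ
  Γ-attractor = Γ-bounded , attracts
    where
    attracts : ∀ i len → 1 ≤ len → i + len ≤ n → HitOccurrence i len
    attracts i (suc L) _ fits with SA-surjective (<-≤-trans (m<m+n i (s≤s z≤n)) fits)
    ... | k , k<n , refl = hitOccurrence k k<n L fits

text-positive : ∀ w → ValidWord w → ∀ s → suc s < length (text w) → at (text w) s ≢ $
text-positive []      _          s       (s≤s ())
text-positive (x ∷ w) (x>0 ∷ _)  zero    _         x≡0 = <-irrefl (sym x≡0) x>0
text-positive (x ∷ w) (_ ∷ valid) (suc s) (s≤s s<) = text-positive w valid s s<

theorem3p9 : (w : List ℕ) → ValidWord w → (SA : List ℕ) →
    IsSuffixArray (text w) SA →
    HasAttractorOfSize (text w) (runs (BWT (text w) SA))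
theorem3p9 w valid SA (perm , sorted) = Γ , Γ-unique , length-Γ , Γ-attractor
  where open RunHeadAttractor (text w) SA perm sorted (text-positive w valid)
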